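{- In the setting described in the context, the map sending a fixed point decoration $h$ to the coloring $i\mapsto(\text{color of }h(i))$ gives a surjection from the set of fixed point decorations onto the set of mismatched colorings of type $\mathbf{k}$; in particular, there is a surjection from fixed point decorations to mismatched colorings, and a fixed point decoration exists if and only if a mismatched coloring exists.
   Context: Let $m\ge3$, $r_1,\dots,r_m\ge1$, $n=\sum r_j$, color classes $C^{(j)}=\{r_1+\dots+r_{j-1}+1,\dots,r_1+\dots+r_j\}$. Exponent data $\mathbf{k}$: for each $j$, $0\le\ell_j\le r_j$; the first $\ell_j$ elements of $C^{(j)}$ have positive integer exponents $k_i$, weakly increasing along $C^{(j)}$; all other $k_i=0$; $\sum k_i=n-3$. Boxed set $\mathrm{Bx}=\{i:k_i>0\}$; crossed-out set $X=\{1,r_1+1,r_1+r_2+1\}$; $k_{C^{(j)}}=\sum_{i\in C^{(j)}}k_i$. A mismatched coloring of type $\mathbf{k}$ is a map $c:[n]\smallsetminus X\to\{1,\dots,m\}$ with $|c^{ -1}(j)|=k_{C^{(j)}}$ for all $j$ and $c(i)\ne j$ whenever $i\in C^{(j)}$ is unboxed. A fixed point decoration is a map $h:[n]\smallsetminus X\to\mathrm{Bx}$ such that: (a) $|h^{ -1}(b)|=k_b$ for every $b\in\mathrm{Bx}$; (b) every unboxed $i$ has $h(i)$ of a color different from that of $i$; (c) no $t$ has permission to merge, defined as follows. For a color $C$, let $I_C$ be the set of boxed $i\in C\smallsetminus X$ with $h(i)\in C$. Number chain order on $I_C$: $i_1=\min I_C$; given $i_1,\dots,i_k$ with $b=h(i_k)$,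 if $b\in I_C\smallsetminus\{i_1,\dots,i_k\}$ then $i_{k+1}=b$ (same chain), else $i_{k+1}=\min(I_C\smallsetminus\{i_1,\dots,i_k\})$ starting a new chain. Boxed $t\in C$ wants to merge with boxed $r\in C$ if $r>t$ and $h(r)=t$; it has permission if (i) $r$ is the first element in number chain order of $\{x\in I_C:h(x)=t\}$, and (ii) with $q$ the element preceding $r$ in its chain (if $r$ does not start a chain; otherwise no $q$) and $S=\{x\in[n]\smallsetminus X:h(x)\in\{t,r\}\}\smallsetminus\{q,r\}$, ordering $S$ by first listing $S\cap C$ in number chain order and then the rest of $S$ increasingly, all elements of hue $r$ precede all elements of hue $t$. Condition (c): there are no $t<r$ in the same color with $t$ wanting to merge with and having permission to merge with $r$. -}

module Defs where

open import Data.Nat using (ℕ; zero; suc; _+_; _∸_; _≤_; _<_; _≡ᵇ_; _≤ᵇ_)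
open import Data.Bool using (Bool; true; false; if_then_else_; _∧_; _∨_; not)
open import Data.List using (List; []; _∷_; _++_; map; filterᵇ; length; take; upTo; head; lookup)
open import Data.Nat.ListAction using (sum)
open import Data.Bool.ListAction using (any)
open import Data.List.Membership.Propositional using (_∈_)
open import Data.Maybe using (Maybe; just; nothing)
open import Data.Fin using (Fin; toℕ)
open import Data.Product using (Σ; _×_; _,_; ∃)
open import Relation.Binary.PropositionalEquality using (_≡_; _≢_)
open import Relation.Nullary using (¬_)

-- The color sizes are given as a list  r = r_1 ∷ … ∷ r_m  (m = length r).
-- Colors are indexed 0,…,m-1 (color index j here is C^(j+1) of the paper).
-- Elements of [n] are the naturals 1,…,n.
-- Exponent data k, colorings c and decorations h are functions on ℕ whose
-- values are only ever inspected on the relevant finite domains.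

nth : List ℕ → ℕ → ℕ
nth []       _       = 0
nth (a ∷ as) zero    = a
nth (a ∷ as) (suc j) = nth as j

total : List ℕ → ℕ
total r = sum r

start : List ℕ → ℕ → ℕ
start r j = sum (take j r)

range1 : ℕ → List ℕ
range1 n = map suc (upTo n)

colorClass : List ℕ → ℕ → List ℕ
colorClass r j = map (λ p → start r j + suc p) (upTo (nth r j))

colorOf : List ℕ → ℕ → ℕ
colorOf []       i = 0
colorOf (a ∷ rs) i = if i ≤ᵇ a then 0 else suc (colorOf rs (i ∸ a))

isXᵇ : List ℕ → ℕ → Bool
isXᵇ r i = (i ≡ᵇ 1) ∨ (i ≡ᵇ (start r 1 + 1)) ∨ (i ≡ᵇ (start r 2 + 1))

dom : List ℕ → List ℕ
dom r = filterᵇ (λ i → not (isXᵇ r i)) (range1 (total r))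

count : (ℕ → Bool) → List ℕ → ℕ
count p xs = length (filterᵇ p xs)

Boxed : (ℕ → ℕ) → ℕ → Set
Boxed k i = 0 < k i

boxedᵇ : (ℕ → ℕ) → ℕ → Bool
boxedᵇ k i = not (k i ≡ᵇ 0)

ColorShape : List ℕ → (ℕ → ℕ) → ℕ → Set
ColorShape r k j =
  Σ ℕ λ ℓ → ℓ ≤ nth r j ×
    ((p : ℕ) → p < nth r j →
        (p < ℓ → 0 < k (start r j + suc p)) × (ℓ ≤ p → k (start r j + suc p) ≡ 0)) ×
    ((p q : ℕ) → p ≤ q → q < ℓ → k (start r j + suc p) ≤ k (start r j + suc q))

ExponentData : List ℕ → (ℕ → ℕ) → Set
ExponentData r k =
  ((j : ℕ) → j < length r → ColorShape r k j) ×
  sum (map k (range1 (total r))) ≡ total r ∸ 3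

kColor : List ℕ → (ℕ → ℕ) → ℕ → ℕ
kColor r k j = sum (map k (colorClass r j))

Mismatched : List ℕ → (ℕ → ℕ) → (ℕ → ℕ) → Set
Mismatched r k c =
  ((i : ℕ) → i ∈ dom r → c i < length r) ×
  ((j : ℕ) → j < length r → count (λ i → c i ≡ᵇ j) (dom r) ≡ kColor r k j) ×
  ((i : ℕ) → i ∈ dom r → k i ≡ 0 → c i ≢ colorOf r i)

memberᵇ : ℕ → List ℕ → Bool
memberᵇ x xs = any (λ y → x ≡ᵇ y) xs

removeᵇ : ℕ → List ℕ → List ℕ
removeᵇ x xs = filterᵇ (λ y → not (x ≡ᵇ y)) xs

IC : List ℕ → (ℕ → ℕ) → (ℕ → ℕ) → ℕ → List ℕ
IC r k h C = filterᵇ (λ i → boxedᵇ k i ∧ (colorOf r i ≡ᵇ C) ∧ (colorOf r (h i) ≡ᵇ C)) (dom r)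

-- one step of number chain order: continue the chain with h(prev) if it is
-- still remaining, else start a new chain with the minimum remaining element.
-- The remaining list is kept in increasing order.
-- the next element: h(prev) if remaining, else the minimum remaining (default y)
chainNext : (ℕ → ℕ) → Maybe ℕ → List ℕ → ℕ → ℕ
chainNext h nothing  R y = y
chainNext h (just p) R y = if memberᵇ (h p) R then h p else y

chainGo : (ℕ → ℕ) → ℕ → Maybe ℕ → List ℕ → List ℕ
chainGo h zero    prev R        = []
chainGo h (suc f) prev []       = []
chainGo h (suc f) prev (y ∷ ys) = nxt ∷ chainGo h f (just nxt) (removeᵇ nxt (y ∷ ys))
  where
  nxt : ℕ
  nxt = chainNext h prev (y ∷ ys) y

chainOrder : List ℕ → (ℕ → ℕ) → (ℕ → ℕ) → ℕ → List ℕ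
chainOrder r k h C = chainGo h (length I) nothing I
  where I = IC r k h C

-- the element preceding x in its chain (nothing if x starts a chain):
-- the predecessor p of x in chain order, provided h(p) = x
chainPred : (ℕ → ℕ) → List ℕ → ℕ → Maybe ℕ
chainPred h []           x = nothing
chainPred h (a ∷ [])     x = nothing
chainPred h (a ∷ b ∷ rest) x =
  if b ≡ᵇ x then (if h a ≡ᵇ x then just a else nothing) else chainPred h (b ∷ rest) x

isJustEqᵇ : Maybe ℕ → ℕ → Bool
isJustEqᵇ nothing  x = false
isJustEqᵇ (just q) x = q ≡ᵇ x

-- t wants to merge with s (s plays the role of r in the paper)
WantsToMerge : List ℕ → (ℕ → ℕ) → (ℕ → ℕ) → ℕ → ℕ → Set
WantsToMerge r k h t s =
  1 ≤ t × t ≤ total r × Boxed k t × Boxed k s ×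
  colorOf r t ≡ colorOf r s × s ∈ dom r × t < s × h s ≡ t

HueOrdered : (ℕ → ℕ) → ℕ → ℕ → List ℕ → Set
HueOrdered h t s L =
  (a b : Fin (length L)) → toℕ a < toℕ b → h (lookup L a) ≡ t → h (lookup L b) ≢ s

inSᵇ : (ℕ → ℕ) → Maybe ℕ → ℕ → ℕ → ℕ → Bool
inSᵇ h q t s x = ((h x ≡ᵇ t) ∨ (h x ≡ᵇ s)) ∧ not (x ≡ᵇ s) ∧ not (isJustEqᵇ q x)

orderedS : List ℕ → (ℕ → ℕ) → (ℕ → ℕ) → ℕ → ℕ → List ℕ
orderedS r k h t s =
  filterᵇ (inSᵇ h q t s) L ++
  filterᵇ (λ x → inSᵇ h q t s x ∧ not (colorOf r x ≡ᵇ C)) (dom r)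
  where
  C = colorOf r t
  L = chainOrder r k h C
  q = chainPred h L s

HasPermission : List ℕ → (ℕ → ℕ) → (ℕ → ℕ) → ℕ → ℕ → Set
HasPermission r k h t s =
  head (filterᵇ (λ x → h x ≡ᵇ t) (chainOrder r k h (colorOf r t))) ≡ just s ×
  HueOrdered h t s (orderedS r k h t s)

Decoration : List ℕ → (ℕ → ℕ) → (ℕ → ℕ) → Set
Decoration r k h =
  ((i : ℕ) → i ∈ dom r → 1 ≤ h i × h i ≤ total r × Boxed k (h i)) ×
  ((b : ℕ) → 1 ≤ b → b ≤ total r → Boxed k b → count (λ i → h i ≡ᵇ b) (dom r) ≡ k b) ×
  ((i : ℕ) → i ∈ dom r → k i ≡ 0 → colorOf r (h i) ≢ colorOf r i) ×
  ((t s : ℕ) → ¬ (WantsToMerge r k h t s × HasPermission r k h t s))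

-- Colouring each i by the colour of h(i) turns a decoration into a mismatched colouring:
-- summing the fibre sizes |h⁻¹(b)| = k_b over a colour class C gives k_C.
-- Conversely, given a mismatched colouring c, make every i with c(i) equal to its own colour
-- a fixed point, h(i) = i; such an i is boxed, since c avoids the own colour of unboxed elements.
-- A boxed b of colour j then has k_b − [b is fixed] vacancies left, and these add up to the
-- number of non-fixed i with c(i) = j, so the non-fixed elements can be distributed greedily
-- over the vacancies of their colour.  Nothing in the result wants to merge: a fixed point s
-- has h(s) = s, and every other s is sent out of its own colour, so the permission clause never
-- has to be examined, and none of the shape conditions on r and k is used.

module Submission where

open import Defs
open import Data.Nat using (ℕ; zero; suc; _+_; _*_; _∸_; _≤_; _<_; _≡ᵇ_; _≤ᵇ_; z≤n; s≤s; z<s; s<s; _≟_; _<?_)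
open import Data.Nat.Properties
open import Data.Bool using (Bool; true; false; if_then_else_; _∧_; _∨_; not; T)
open import Data.Bool.Properties using (∧-zeroʳ)
open import Data.List using (List; []; _∷_; _++_; map; filterᵇ; length; replicate; concatMap)
open import Data.List.Properties using (length-++; length-replicate; map-cong-local)
open import Data.Nat.ListAction using (sum)
open import Data.List.Relation.Unary.All as All using (All)
open import Data.List.Relation.Unary.AllPairs using (_∷_)
open import Data.List.Relation.Unary.Any using (here; there)
open import Data.List.Relation.Unary.Unique.Propositional using (Unique)
import Data.List.Relation.Unary.Unique.Propositional.Properties as Unique
open import Data.List.Membership.Propositional using (_∈_; _∉_)
open import Data.List.Membership.Propositional.Properties
  using (∈-filter⁻; ∈-filter⁺; ∈-map⁻; ∈-map⁺; ∈-upTo⁻; ∈-upTo⁺; ∈-++⁻)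
open import Data.Product using (Σ; _×_; _,_; ∃; proj₁; proj₂)
open import Data.Sum using (inj₁; inj₂)
open import Data.Unit using (tt)
open import Algebra.Properties.CommutativeSemigroup +-commutativeSemigroup using (interchange)
open import Relation.Binary.PropositionalEquality
open import Relation.Nullary using (¬_; yes; no; contradiction)
open import Relation.Nullary.Reflects using (Reflects; ofʸ; ofⁿ; fromEquivalence; det)
open import Relation.Nullary.Decidable using (T?; dec-true; dec-false)
open import Function.Bundles using (_⇔_; mk⇔)


≡ᵇ-reflects : ∀ m n → Reflects (m ≡ n) (m ≡ᵇ n)
≡ᵇ-reflects m n = fromEquivalence (≡ᵇ⇒≡ m n) (≡⇒≡ᵇ m n)

≡⇒≡ᵇ-true : ∀ m n → m ≡ n → (m ≡ᵇ n) ≡ true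
≡⇒≡ᵇ-true m n = dec-true (m ≟ n)

≡ᵇ-refl : ∀ n → (n ≡ᵇ n) ≡ true
≡ᵇ-refl n = ≡⇒≡ᵇ-true n n refl

≢⇒≡ᵇ-false : ∀ m n → m ≢ n → (m ≡ᵇ n) ≡ false
≢⇒≡ᵇ-false m n = dec-false (m ≟ n)

≡ᵇ-true⇒≡ : ∀ {m n} → (m ≡ᵇ n) ≡ true → m ≡ n
≡ᵇ-true⇒≡ {m} {n} e = ≡ᵇ⇒≡ m n (subst T (sym e) tt)

memberᵇ-reflects : ∀ x xs → Reflects (x ∈ xs) (memberᵇ x xs)
memberᵇ-reflects x []       = ofⁿ λ ()
memberᵇ-reflects x (y ∷ ys) with x ≡ᵇ y | ≡ᵇ-reflects x y
... | true  | ofʸ x≡y = ofʸ (here x≡y)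
... | false | ofⁿ x≢y with memberᵇ x ys | memberᵇ-reflects x ys
...   | true  | ofʸ x∈ys = ofʸ (there x∈ys)
...   | false | ofⁿ x∉ys = ofⁿ λ { (here x≡y) → x≢y x≡y ; (there x∈ys) → x∉ys x∈ys }

count-accept : ∀ (p : ℕ → Bool) x xs → p x ≡ true → count p (x ∷ xs) ≡ suc (count p xs)
count-accept p x xs px rewrite px = refl

count-reject : ∀ (p : ℕ → Bool) x xs → p x ≡ false → count p (x ∷ xs) ≡ count p xs
count-reject p x xs px rewrite px = refl

count-∷-cong : ∀ (p q : ℕ → Bool) {x y xs ys} →
  p x ≡ q y → count p xs ≡ count q ys → count p (x ∷ xs) ≡ count q (y ∷ ys)
count-∷-cong p q {x} {y} px≡qy rest with p x | q y
... | true  | true  = cong suc rest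
... | false | false = rest
... | true  | false = contradiction px≡qy λ ()
... | false | true  = contradiction px≡qy λ ()

count-cong : ∀ {p q : ℕ → Bool} xs → (∀ x → x ∈ xs → p x ≡ q x) → count p xs ≡ count q xs
count-cong []       _   = refl
count-cong {p} {q} (x ∷ xs) p≗q = count-∷-cong p q (p≗q x (here refl)) (count-cong xs (λ y y∈ → p≗q y (there y∈)))

count-none : ∀ {p : ℕ → Bool} xs → (∀ x → x ∈ xs → p x ≡ false) → count p xs ≡ 0
count-none []       _    = refl
count-none {p} (x ∷ xs) none =
  trans (count-reject p x xs (none x (here refl))) (count-none xs (λ y y∈ → none y (there y∈)))

count-++ : ∀ (p : ℕ → Bool) xs ys → count p (xs ++ ys) ≡ count p xs + count p ys
count-++ p []       ys = refl
count-++ p (x ∷ xs) ys with p x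
... | true  = cong suc (count-++ p xs ys)
... | false = count-++ p xs ys

count-partition : ∀ (p q : ℕ → Bool) xs →
  count p xs ≡ count p (filterᵇ q xs) + count p (filterᵇ (λ x → not (q x)) xs)
count-partition p q []       = refl
count-partition p q (x ∷ xs) with q x
... | true  with p x
...   | true  = cong suc (count-partition p q xs)
...   | false = count-partition p q xs
count-partition p q (x ∷ xs) | false with p x
...   | true  = trans (cong suc (count-partition p q xs)) (sym (+-suc _ _))
...   | false = count-partition p q xs

count-∨-disjoint : ∀ (p q : ℕ → Bool) xs → (∀ x → x ∈ xs → p x ≡ true → q x ≡ false) →
  count (λ x → p x ∨ q x) xs ≡ count p xs + count q xs
count-∨-disjoint p q []       _        = refl
count-∨-disjoint p q (x ∷ xs) disjoint with p x in px | q x in qx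
... | true  | true  = contradiction (trans (sym qx) (disjoint x (here refl) px)) λ ()
... | true  | false = cong suc (count-∨-disjoint p q xs (λ y y∈ → disjoint y (there y∈)))
... | false | true  = trans (cong suc (count-∨-disjoint p q xs (λ y y∈ → disjoint y (there y∈)))) (sym (+-suc _ _))
... | false | false = count-∨-disjoint p q xs (λ y y∈ → disjoint y (there y∈))

count-fibres : ∀ (f : ℕ → ℕ) B xs → Unique B →
  count (λ x → memberᵇ (f x) B) xs ≡ sum (map (λ b → count (λ x → f x ≡ᵇ b) xs) B)
count-fibres f []      xs _              = count-none xs (λ _ _ → refl)
count-fibres f (b ∷ B) xs (b∉B ∷ uniqueB) =
  trans (count-∨-disjoint (λ x → f x ≡ᵇ b) (λ x → memberᵇ (f x) B) xs disjoint)
        (cong (count (λ x → f x ≡ᵇ b) xs +_) (count-fibres f B xs uniqueB))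
  where
  disjoint : ∀ x → x ∈ xs → (f x ≡ᵇ b) ≡ true → memberᵇ (f x) B ≡ false
  disjoint x _ fx≡b = det (memberᵇ-reflects (f x) B)
    (ofⁿ λ fx∈B → All.lookup b∉B fx∈B (sym (≡ᵇ-true⇒≡ fx≡b)))

count-≡ᵇ-∉ : ∀ {b} xs → b ∉ xs → count (_≡ᵇ b) xs ≡ 0
count-≡ᵇ-∉ {b} xs b∉xs = count-none xs λ x x∈xs → ≢⇒≡ᵇ-false x b λ { refl → b∉xs x∈xs }

count-≡ᵇ-∈ : ∀ {b} xs → Unique xs → b ∈ xs → count (_≡ᵇ b) xs ≡ 1
count-≡ᵇ-∈ (x ∷ xs) (x∉xs ∷ _) (here refl) =
  trans (count-accept (_≡ᵇ x) x xs (≡ᵇ-refl x)) (cong suc (count-≡ᵇ-∉ xs (λ x∈xs → All.lookup x∉xs x∈xs refl)))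
count-≡ᵇ-∈ {b} (x ∷ xs) (x∉xs ∷ uniq) (there b∈xs) =
  trans (count-reject (_≡ᵇ b) x xs (≢⇒≡ᵇ-false x b λ { refl → All.lookup x∉xs b∈xs refl })) (count-≡ᵇ-∈ xs uniq b∈xs)

count-≡ᵇ-≤1 : ∀ b xs → Unique xs → count (_≡ᵇ b) xs ≤ 1
count-≡ᵇ-≤1 b xs uniq with memberᵇ b xs | memberᵇ-reflects b xs
... | true  | ofʸ b∈xs = ≤-reflexive (count-≡ᵇ-∈ xs uniq b∈xs)
... | false | ofⁿ b∉xs = ≤-trans (≤-reflexive (count-≡ᵇ-∉ xs b∉xs)) z≤n

colorOf-shift : ∀ a rs x → 0 < x → colorOf (a ∷ rs) (a + x) ≡ suc (colorOf rs x)
colorOf-shift a rs x 0<x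
  rewrite det (≤ᵇ-reflects-≤ (a + x) a) (ofⁿ (<⇒≱ (m<m+n a 0<x))) =
  cong (λ y → suc (colorOf rs y)) (m+n∸m≡n a x)

colorOf-colorClass : ∀ r j p → p < nth r j → colorOf r (start r j + suc p) ≡ j
colorOf-colorClass (a ∷ rs) zero    p p<a rewrite det (≤ᵇ-reflects-≤ (suc p) a) (ofʸ p<a) = refl
colorOf-colorClass (a ∷ rs) (suc j) p p<r = begin
  colorOf (a ∷ rs) (a + start rs j + suc p)   ≡⟨ cong (colorOf (a ∷ rs)) (+-assoc a (start rs j) (suc p)) ⟩
  colorOf (a ∷ rs) (a + (start rs j + suc p)) ≡⟨ colorOf-shift a rs _ (≤-trans (s≤s z≤n) (m≤n+m (suc p) (start rs j))) ⟩
  suc (colorOf rs (start rs j + suc p))       ≡⟨ cong suc (colorOf-colorClass rs j p p<r) ⟩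
  suc j                                       ∎
  where open ≡-Reasoning

colorClass-≤-total : ∀ r j p → p < nth r j → start r j + suc p ≤ total r
colorClass-≤-total (a ∷ rs) zero    p p<a = ≤-trans p<a (m≤m+n a (total rs))
colorClass-≤-total (a ∷ rs) (suc j) p p<r =
  ≤-trans (≤-reflexive (+-assoc a (start rs j) (suc p))) (+-monoʳ-≤ a (colorClass-≤-total rs j p p<r))

<nth⇒<length : ∀ r j p → p < nth r j → j < length r
<nth⇒<length (a ∷ rs) zero    p _   = z<s
<nth⇒<length (a ∷ rs) (suc j) p p<r = s<s (<nth⇒<length rs j p p<r)

colorClass-offset : ∀ r b → 1 ≤ b → b ≤ total r →
  Σ ℕ λ p → p < nth r (colorOf r b) × b ≡ start r (colorOf r b) + suc p
colorClass-offset (a ∷ rs) (suc b) _ b≤r with suc b ≤ᵇ a | ≤ᵇ-reflects-≤ (suc b) a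
... | true  | ofʸ b<a = b , b<a , refl
... | false | ofⁿ b≮a
  with p , p<r , eq ← colorClass-offset rs (suc b ∸ a) (m<n⇒0<n∸m (≰⇒> b≮a)) (m≤n+o⇒m∸n≤o (suc b) a b≤r) =
  p , p<r , (begin
    suc b                                     ≡⟨ m+[n∸m]≡n (<⇒≤ (≰⇒> b≮a)) ⟨
    a + (suc b ∸ a)                           ≡⟨ cong (a +_) eq ⟩
    a + (start rs (colorOf rs (suc b ∸ a)) + suc p) ≡⟨ +-assoc a _ (suc p) ⟨
    a + start rs (colorOf rs (suc b ∸ a)) + suc p   ∎)
  where open ≡-Reasoning

∈-colorClass⁻ : ∀ r j b → b ∈ colorClass r j → colorOf r b ≡ j × 1 ≤ b × b ≤ total r × j < length r
∈-colorClass⁻ r j b b∈ with p , p∈ , refl ← ∈-map⁻ (λ q → start r j + suc q) b∈ =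
  let p<r = ∈-upTo⁻ p∈ in
  colorOf-colorClass r j p p<r , ≤-trans (s≤s z≤n) (m≤n+m (suc p) (start r j)) ,
  colorClass-≤-total r j p p<r , <nth⇒<length r j p p<r

∈-colorClass⁺ : ∀ r b → 1 ≤ b → b ≤ total r → b ∈ colorClass r (colorOf r b)
∈-colorClass⁺ r b 1≤b b≤r with p , p<r , eq ← colorClass-offset r b 1≤b b≤r =
  subst (_∈ colorClass r (colorOf r b)) (sym eq) (∈-map⁺ (λ q → start r (colorOf r b) + suc q) (∈-upTo⁺ p<r))

colorOf<length : ∀ r b → 1 ≤ b → b ≤ total r → colorOf r b < length r
colorOf<length r b 1≤b b≤r = proj₂ (proj₂ (proj₂ (∈-colorClass⁻ r _ b (∈-colorClass⁺ r b 1≤b b≤r))))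

colorClass-unique : ∀ r j → Unique (colorClass r j)
colorClass-unique r j =
  Unique.map⁺ (λ eq → suc-injective (+-cancelˡ-≡ (start r j) _ _ eq)) (Unique.upTo⁺ (nth r j))

memberᵇ-colorClass : ∀ r j x → 1 ≤ x → x ≤ total r → memberᵇ x (colorClass r j) ≡ (colorOf r x ≡ᵇ j)
memberᵇ-colorClass r j x 1≤x x≤r with colorOf r x ≡ᵇ j | ≡ᵇ-reflects (colorOf r x) j
... | true  | ofʸ refl = det (memberᵇ-reflects x _) (ofʸ (∈-colorClass⁺ r x 1≤x x≤r))
... | false | ofⁿ col≢j = det (memberᵇ-reflects x _) (ofⁿ λ x∈j → col≢j (proj₁ (∈-colorClass⁻ r j x x∈j)))

nth-beyond : ∀ r j → length r ≤ j → nth r j ≡ 0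
nth-beyond []       j       _         = refl
nth-beyond (a ∷ rs) (suc j) (s≤s r≤j) = nth-beyond rs j r≤j

colorClass-beyond : ∀ r j → length r ≤ j → colorClass r j ≡ []
colorClass-beyond r j r≤j rewrite nth-beyond r j r≤j = refl

∈-dom⁻ : ∀ r i → i ∈ dom r → 1 ≤ i × i ≤ total r
∈-dom⁻ r i i∈ with i∈range , _ ← ∈-filter⁻ (λ i → T? (not (isXᵇ r i))) {xs = range1 (total r)} i∈
  with p , p∈ , refl ← ∈-map⁻ suc i∈range = s≤s z≤n , ∈-upTo⁻ p∈

dom-unique : ∀ r → Unique (dom r)
dom-unique r = Unique.filter⁺ (λ i → T? (not (isXᵇ r i))) (Unique.map⁺ suc-injective (Unique.upTo⁺ (total r)))

copies : (ℕ → ℕ) → List ℕ → List ℕ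
copies v B = concatMap (λ b → replicate (v b) b) B

∈-replicate⁻ : ∀ m {b y : ℕ} → y ∈ replicate m b → y ≡ b × 0 < m
∈-replicate⁻ (suc m) (here y≡b) = y≡b , z<s
∈-replicate⁻ (suc m) (there y∈) = proj₁ (∈-replicate⁻ m y∈) , z<s

∈-copies⁻ : ∀ v B {y} → y ∈ copies v B → y ∈ B × 0 < v y
∈-copies⁻ v (b ∷ B) y∈ with ∈-++⁻ (replicate (v b) b) y∈
... | inj₁ y∈b* with refl , 0<vb ← ∈-replicate⁻ (v b) y∈b* = here refl , 0<vb
... | inj₂ y∈B* with y∈B , 0<vy ← ∈-copies⁻ v B y∈B* = there y∈B , 0<vy

length-copies : ∀ v B → length (copies v B) ≡ sum (map v B)
length-copies v []      = refl
length-copies v (b ∷ B) =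
  trans (length-++ (replicate (v b) b)) (cong₂ _+_ (length-replicate (v b)) (length-copies v B))

count-replicate : ∀ m b → count (_≡ᵇ b) (replicate m b) ≡ m
count-replicate zero    b = refl
count-replicate (suc m) b =
  trans (count-accept (_≡ᵇ b) b (replicate m b) (≡ᵇ-refl b)) (cong suc (count-replicate m b))

count-copies : ∀ v B b → count (_≡ᵇ b) (copies v B) ≡ count (_≡ᵇ b) B * v b
count-copies v []      b = refl
count-copies v (a ∷ B) b with a ≟ b
... | yes refl = begin
  count (_≡ᵇ a) (replicate (v a) a ++ copies v B)          ≡⟨ count-++ (_≡ᵇ a) (replicate (v a) a) _ ⟩
  count (_≡ᵇ a) (replicate (v a) a) + count (_≡ᵇ a) (copies v B)
    ≡⟨ cong₂ _+_ (count-replicate (v a) a) (count-copies v B a) ⟩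
  suc (count (_≡ᵇ a) B) * v a                              ≡⟨ cong (_* v a) (count-accept (_≡ᵇ a) a B (≡ᵇ-refl a)) ⟨
  count (_≡ᵇ a) (a ∷ B) * v a                              ∎
  where open ≡-Reasoning
... | no a≢b = begin
  count (_≡ᵇ b) (replicate (v a) a ++ copies v B)          ≡⟨ count-++ (_≡ᵇ b) (replicate (v a) a) _ ⟩
  count (_≡ᵇ b) (replicate (v a) a) + count (_≡ᵇ b) (copies v B)
    ≡⟨ cong₂ _+_ (count-none (replicate (v a) a) λ y y∈ → ≢⇒≡ᵇ-false y b λ { refl → a≢b (sym (proj₁ (∈-replicate⁻ (v a) y∈))) })
                 (count-copies v B b) ⟩
  count (_≡ᵇ b) B * v b                                    ≡⟨ cong (_* v b) (count-reject (_≡ᵇ b) a B (≢⇒≡ᵇ-false a b a≢b)) ⟨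
  count (_≡ᵇ b) (a ∷ B) * v b                              ∎
  where open ≡-Reasoning

update : (ℕ → List ℕ) → ℕ → List ℕ → ℕ → List ℕ
update T j s i = if i ≡ᵇ j then s else T i

update-same : ∀ T j s → update T j s j ≡ s
update-same T j s rewrite ≡ᵇ-refl j = refl

update-other : ∀ T j s i → i ≢ j → update T j s i ≡ T i
update-other T j s i i≢j rewrite ≢⇒≡ᵇ-false i j i≢j = refl

Fits : (ℕ → ℕ) → List ℕ → (ℕ → List ℕ) → Set
Fits c L slots = ∀ j → length (slots j) ≡ count (λ x → c x ≡ᵇ j) L

Fills : (ℕ → ℕ) → List ℕ → (ℕ → List ℕ) → (ℕ → ℕ) → Set
Fills c L slots g =
  (∀ x → x ∈ L → g x ∈ slots (c x)) ×
  (∀ j b → count (λ x → (c x ≡ᵇ j) ∧ (g x ≡ᵇ b)) L ≡ count (_≡ᵇ b) (slots j))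

Fits-pop : ∀ c x xs slots {y ys} → slots (c x) ≡ y ∷ ys →
  Fits c (x ∷ xs) slots → Fits c xs (update slots (c x) ys)
Fits-pop c x xs slots {y} {ys} slots-cx fits j with j ≟ c x
... | yes refl = suc-injective (begin
  suc (length (update slots (c x) ys (c x)))  ≡⟨ cong (λ s → suc (length s)) (update-same slots (c x) ys) ⟩
  length (y ∷ ys)                           ≡⟨ cong length slots-cx ⟨
  length (slots (c x))                      ≡⟨ fits (c x) ⟩
  count (λ z → c z ≡ᵇ c x) (x ∷ xs)         ≡⟨ count-accept (λ z → c z ≡ᵇ c x) x xs (≡ᵇ-refl (c x)) ⟩
  suc (count (λ z → c z ≡ᵇ c x) xs)         ∎)
  where open ≡-Reasoning
... | no j≢cx = begin
  length (update slots (c x) ys j)          ≡⟨ cong length (update-other slots (c x) ys j j≢cx) ⟩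
  length (slots j)                          ≡⟨ fits j ⟩
  count (λ z → c z ≡ᵇ j) (x ∷ xs)           ≡⟨ count-reject (λ z → c z ≡ᵇ j) x xs (≢⇒≡ᵇ-false (c x) j (≢-sym j≢cx)) ⟩
  count (λ z → c z ≡ᵇ j) xs                 ∎
  where open ≡-Reasoning

update-pop-⊆ : ∀ slots j {y ys} → slots j ≡ y ∷ ys → ∀ i {w} → w ∈ update slots j ys i → w ∈ slots i
update-pop-⊆ slots j {ys = ys} slots-j i {w} w∈ with i ≟ j
... | yes refl = subst (w ∈_) (sym slots-j) (there (subst (w ∈_) (update-same slots j ys) w∈))
... | no i≢j   = subst (w ∈_) (update-other slots j ys i i≢j) w∈

fill-slots : ∀ (c : ℕ → ℕ) L (slots : ℕ → List ℕ) → Unique L → Fits c L slots →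
  Σ (ℕ → ℕ) (Fills c L slots)
fill-slots c [] slots _ fits = (λ _ → 0) , (λ _ ()) , no-slots
  where
  no-slots : ∀ j b → 0 ≡ count (_≡ᵇ b) (slots j)
  no-slots j b with slots j | fits j
  ... | [] | _ = refl
fill-slots c (x ∷ xs) slots (x∉xs ∷ uniq) fits with slots (c x) in slots-cx
... | [] = contradiction (trans (cong length (sym slots-cx))
                                (trans (fits (c x)) (count-accept (λ z → c z ≡ᵇ c x) x xs (≡ᵇ-refl (c x))))) λ ()
... | y ∷ ys = g , g∈slots , g-count
  where
  open ≡-Reasoning

  slots′ : ℕ → List ℕ
  slots′ = update slots (c x) ys

  rest : Σ (ℕ → ℕ) (Fills c xs slots′)
  rest = fill-slots c xs slots′ uniq (Fits-pop c x xs slots slots-cx fits)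

  g : ℕ → ℕ
  g z = if z ≡ᵇ x then y else proj₁ rest z

  g-here : g x ≡ y
  g-here rewrite ≡ᵇ-refl x = refl

  g-there : ∀ z → z ∈ xs → g z ≡ proj₁ rest z
  g-there z z∈xs rewrite ≢⇒≡ᵇ-false z x (λ { refl → All.lookup x∉xs z∈xs refl }) = refl

  g∈slots : ∀ z → z ∈ x ∷ xs → g z ∈ slots (c z)
  g∈slots z (here refl)  = subst₂ _∈_ (sym g-here) (sym slots-cx) (here refl)
  g∈slots z (there z∈xs) = subst (_∈ slots (c z)) (sym (g-there z z∈xs))
    (update-pop-⊆ slots (c x) slots-cx (c z) (proj₁ (proj₂ rest) z z∈xs))

  count-rest : ∀ j b → count (λ z → (c z ≡ᵇ j) ∧ (g z ≡ᵇ b)) xs ≡ count (_≡ᵇ b) (slots′ j)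
  count-rest j b =
    trans (count-cong xs λ z z∈xs → cong (λ w → (c z ≡ᵇ j) ∧ (w ≡ᵇ b)) (g-there z z∈xs))
          (proj₂ (proj₂ rest) j b)

  g-count : ∀ j b → count (λ z → (c z ≡ᵇ j) ∧ (g z ≡ᵇ b)) (x ∷ xs) ≡ count (_≡ᵇ b) (slots j)
  g-count j b with j ≟ c x
  ... | yes refl = begin
    count (λ z → (c z ≡ᵇ c x) ∧ (g z ≡ᵇ b)) (x ∷ xs)
      ≡⟨ count-∷-cong (λ z → (c z ≡ᵇ c x) ∧ (g z ≡ᵇ b)) (_≡ᵇ b) {x} {y} head
           (trans (count-rest (c x) b) (cong (count (_≡ᵇ b)) (update-same slots (c x) ys))) ⟩
    count (_≡ᵇ b) (y ∷ ys)                    ≡⟨ cong (count (_≡ᵇ b)) slots-cx ⟨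
    count (_≡ᵇ b) (slots (c x))               ∎
    where
    head : (c x ≡ᵇ c x) ∧ (g x ≡ᵇ b) ≡ (y ≡ᵇ b)
    head rewrite ≡ᵇ-refl (c x) | g-here = refl
  ... | no j≢cx = begin
    count (λ z → (c z ≡ᵇ j) ∧ (g z ≡ᵇ b)) (x ∷ xs)
      ≡⟨ count-reject (λ z → (c z ≡ᵇ j) ∧ (g z ≡ᵇ b)) x xs
           (cong (_∧ (g x ≡ᵇ b)) (≢⇒≡ᵇ-false (c x) j (≢-sym j≢cx))) ⟩
    count (λ z → (c z ≡ᵇ j) ∧ (g z ≡ᵇ b)) xs  ≡⟨ count-rest j b ⟩
    count (_≡ᵇ b) (slots′ j)                  ≡⟨ cong (count (_≡ᵇ b)) (update-other slots (c x) ys j j≢cx) ⟩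
    count (_≡ᵇ b) (slots j)                   ∎

decoration⇒fibre≡k : ∀ r k h → Decoration r k h → ∀ b → 1 ≤ b → b ≤ total r →
  count (λ i → h i ≡ᵇ b) (dom r) ≡ k b
decoration⇒fibre≡k r k h (into , fibres , _) b 1≤b b≤r with k b in kb
... | suc _ = trans (fibres b 1≤b b≤r (subst (0 <_) (sym kb) z<s)) kb
... | zero  = count-none (dom r) λ i i∈ → ≢⇒≡ᵇ-false (h i) b λ { refl →
                <-irrefl refl (subst (0 <_) kb (proj₂ (proj₂ (into i i∈)))) }

decoration⇒mismatched : ∀ r k h → Decoration r k h → Mismatched r k (λ i → colorOf r (h i))
decoration⇒mismatched r k h dec@(into , _ , offColor , _) = colorsInRange , colorCounts , offColor
  where
  open ≡-Reasoning

  colorsInRange : ∀ i → i ∈ dom r → colorOf r (h i) < length r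
  colorsInRange i i∈ = colorOf<length r (h i) (proj₁ (into i i∈)) (proj₁ (proj₂ (into i i∈)))

  colorCounts : ∀ j → j < length r → count (λ i → colorOf r (h i) ≡ᵇ j) (dom r) ≡ kColor r k j
  colorCounts j _ = begin
    count (λ i → colorOf r (h i) ≡ᵇ j) (dom r)
      ≡⟨ count-cong (dom r) (λ i i∈ → sym (memberᵇ-colorClass r j (h i) (proj₁ (into i i∈)) (proj₁ (proj₂ (into i i∈))))) ⟩
    count (λ i → memberᵇ (h i) (colorClass r j)) (dom r)
      ≡⟨ count-fibres h (colorClass r j) (dom r) (colorClass-unique r j) ⟩
    sum (map (λ b → count (λ i → h i ≡ᵇ b) (dom r)) (colorClass r j))
      ≡⟨ cong sum (map-cong-local (All.tabulate λ {b} b∈ →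
           let _ , 1≤b , b≤r , _ = ∈-colorClass⁻ r j b b∈ in decoration⇒fibre≡k r k h dec b 1≤b b≤r)) ⟩
    kColor r k j ∎

sum-map-∸-+ : ∀ (v w : ℕ → ℕ) B → (∀ b → b ∈ B → w b ≤ v b) →
  sum (map (λ b → v b ∸ w b) B) + sum (map w B) ≡ sum (map v B)
sum-map-∸-+ v w []      _   = refl
sum-map-∸-+ v w (b ∷ B) w≤v =
  trans (interchange (v b ∸ w b) _ (w b) _)
        (cong₂ _+_ (m∸n+n≡m (w≤v b (here refl))) (sum-map-∸-+ v w B (λ b′ b′∈ → w≤v b′ (there b′∈))))

module FromMismatched (r : List ℕ) (k : ℕ → ℕ) (c : ℕ → ℕ) (mis : Mismatched r k c) where
  open ≡-Reasoning

  fixedᵇ : ℕ → Bool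
  fixedᵇ i = c i ≡ᵇ colorOf r i

  Fixed Moving : List ℕ
  Fixed  = filterᵇ fixedᵇ (dom r)
  Moving = filterᵇ (λ i → not (fixedᵇ i)) (dom r)

  Fixed-unique : Unique Fixed
  Fixed-unique = Unique.filter⁺ (λ i → T? (fixedᵇ i)) (dom-unique r)

  Moving-unique : Unique Moving
  Moving-unique = Unique.filter⁺ (λ i → T? (not (fixedᵇ i))) (dom-unique r)

  ∈-Fixed⁻ : ∀ {i} → i ∈ Fixed → i ∈ dom r × c i ≡ colorOf r i
  ∈-Fixed⁻ {i} i∈ with i∈dom , fixed ← ∈-filter⁻ (λ i → T? (fixedᵇ i)) {xs = dom r} i∈ =
    i∈dom , ≡ᵇ⇒≡ (c i) (colorOf r i) fixed

  ∈-Moving⁻ : ∀ {i} → i ∈ Moving → i ∈ dom r × c i ≢ colorOf r i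
  ∈-Moving⁻ {i} i∈ with i∈dom , moving ← ∈-filter⁻ (λ i → T? (not (fixedᵇ i))) {xs = dom r} i∈ =
    i∈dom , λ fixed → subst (λ w → T (not w)) (≡⇒≡ᵇ-true (c i) (colorOf r i) fixed) moving

  ∈-Moving⁺ : ∀ {i} → i ∈ dom r → c i ≢ colorOf r i → i ∈ Moving
  ∈-Moving⁺ {i} i∈ moving = ∈-filter⁺ (λ i → T? (not (fixedᵇ i))) i∈
    (subst (λ w → T (not w)) (sym (≢⇒≡ᵇ-false (c i) (colorOf r i) moving)) tt)

  fixed⇒boxed : ∀ i → i ∈ dom r → c i ≡ colorOf r i → 0 < k i
  fixed⇒boxed i i∈ fixed with k i in ki
  ... | suc _ = z<s
  ... | zero  = contradiction fixed (proj₂ (proj₂ mis) i i∈ ki)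

  fixedAt : ℕ → ℕ
  fixedAt b = count (_≡ᵇ b) Fixed

  fixedAt≤k : ∀ b → fixedAt b ≤ k b
  fixedAt≤k b with k b in kb
  ... | suc _ = ≤-trans (count-≡ᵇ-≤1 b Fixed Fixed-unique) (s≤s z≤n)
  ... | zero  = ≤-reflexive (count-none Fixed λ i i∈ → ≢⇒≡ᵇ-false i b λ { refl →
                  let i∈dom , fixed = ∈-Fixed⁻ i∈ in
                  <-irrefl refl (subst (0 <_) kb (fixed⇒boxed i i∈dom fixed)) })

  colorCount : ∀ j → count (λ i → c i ≡ᵇ j) (dom r) ≡ kColor r k j
  colorCount j with j <? length r
  ... | yes j<r = proj₁ (proj₂ mis) j j<r
  ... | no  j≮r rewrite colorClass-beyond r j (≮⇒≥ j≮r) =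
    count-none (dom r) λ i i∈ → ≢⇒≡ᵇ-false (c i) j λ { refl → j≮r (proj₁ mis i i∈) }

  fixedColorCount : ∀ j → count (λ i → c i ≡ᵇ j) Fixed ≡ sum (map fixedAt (colorClass r j))
  fixedColorCount j =
    trans (count-cong Fixed λ i i∈ →
             let i∈dom , fixed = ∈-Fixed⁻ i∈ ; 1≤i , i≤r = ∈-dom⁻ r i i∈dom in
             trans (cong (_≡ᵇ j) fixed) (sym (memberᵇ-colorClass r j i 1≤i i≤r)))
          (count-fibres (λ i → i) (colorClass r j) Fixed (colorClass-unique r j))

  vacancies : ℕ → ℕ
  vacancies b = k b ∸ fixedAt b

  slots : ℕ → List ℕ
  slots j = copies vacancies (colorClass r j)

  slots-fit : Fits c Moving slots
  slots-fit j = +-cancelʳ-≡ (sum (map fixedAt (colorClass r j))) _ _ (begin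
    length (slots j) + sum (map fixedAt (colorClass r j))
      ≡⟨ cong (_+ sum (map fixedAt (colorClass r j))) (length-copies vacancies (colorClass r j)) ⟩
    sum (map vacancies (colorClass r j)) + sum (map fixedAt (colorClass r j))
      ≡⟨ sum-map-∸-+ k fixedAt (colorClass r j) (λ b _ → fixedAt≤k b) ⟩
    kColor r k j
      ≡⟨ colorCount j ⟨
    count (λ i → c i ≡ᵇ j) (dom r)
      ≡⟨ count-partition (λ i → c i ≡ᵇ j) fixedᵇ (dom r) ⟩
    count (λ i → c i ≡ᵇ j) Fixed + count (λ i → c i ≡ᵇ j) Moving
      ≡⟨ +-comm (count (λ i → c i ≡ᵇ j) Fixed) _ ⟩
    count (λ i → c i ≡ᵇ j) Moving + count (λ i → c i ≡ᵇ j) Fixed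
      ≡⟨ cong (count (λ i → c i ≡ᵇ j) Moving +_) (fixedColorCount j) ⟩
    count (λ i → c i ≡ᵇ j) Moving + sum (map fixedAt (colorClass r j)) ∎)

  -- Opaque, so that with-abstracting or rewriting over move i never runs the greedy filling.
  opaque
    moved : Σ (ℕ → ℕ) (Fills c Moving slots)
    moved = fill-slots c Moving slots Moving-unique slots-fit

  move : ℕ → ℕ
  move = proj₁ moved

  move-lands : ∀ i → i ∈ Moving →
    colorOf r (move i) ≡ c i × 1 ≤ move i × move i ≤ total r × Boxed k (move i)
  move-lands i i∈ =
    let m∈C , 0<vacancies = ∈-copies⁻ vacancies (colorClass r (c i)) (proj₁ (proj₂ moved) i i∈)
        col , 1≤m , m≤r , _ = ∈-colorClass⁻ r (c i) (move i) m∈C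
    in col , 1≤m , m≤r , ≤-trans 0<vacancies (m∸n≤m (k (move i)) (fixedAt (move i)))

  move≡ᵇ : ∀ i → i ∈ Moving → ∀ b → (move i ≡ᵇ b) ≡ (c i ≡ᵇ colorOf r b) ∧ (move i ≡ᵇ b)
  move≡ᵇ i i∈ b with move i ≟ b
  ... | yes refl rewrite ≡⇒≡ᵇ-true (c i) _ (sym (proj₁ (move-lands i i∈))) = refl
  ... | no  m≢b  rewrite ≢⇒≡ᵇ-false (move i) b m≢b = sym (∧-zeroʳ _)

  decoration : ℕ → ℕ
  decoration i = if fixedᵇ i then i else move i

  decoration-fixed : ∀ i → c i ≡ colorOf r i → decoration i ≡ i
  decoration-fixed i fixed rewrite ≡⇒≡ᵇ-true (c i) (colorOf r i) fixed = refl

  decoration-moving : ∀ i → c i ≢ colorOf r i → decoration i ≡ move i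
  decoration-moving i moving rewrite ≢⇒≡ᵇ-false (c i) (colorOf r i) moving = refl

  colorOf-decoration : ∀ i → i ∈ dom r → colorOf r (decoration i) ≡ c i
  colorOf-decoration i i∈ with c i ≟ colorOf r i
  ... | yes fixed  = trans (cong (colorOf r) (decoration-fixed i fixed)) (sym fixed)
  ... | no  moving = trans (cong (colorOf r) (decoration-moving i moving))
                           (proj₁ (move-lands i (∈-Moving⁺ i∈ moving)))

  decoration-into : ∀ i → i ∈ dom r →
    1 ≤ decoration i × decoration i ≤ total r × Boxed k (decoration i)
  decoration-into i i∈ with c i ≟ colorOf r i
  ... | yes fixed  rewrite decoration-fixed i fixed =
    proj₁ (∈-dom⁻ r i i∈) , proj₂ (∈-dom⁻ r i i∈) , fixed⇒boxed i i∈ fixed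
  ... | no  moving rewrite decoration-moving i moving = proj₂ (move-lands i (∈-Moving⁺ i∈ moving))

  fibre≡k : ∀ b → 1 ≤ b → b ≤ total r → count (λ i → decoration i ≡ᵇ b) (dom r) ≡ k b
  fibre≡k b 1≤b b≤r = begin
    count (λ i → decoration i ≡ᵇ b) (dom r)
      ≡⟨ count-partition (λ i → decoration i ≡ᵇ b) fixedᵇ (dom r) ⟩
    count (λ i → decoration i ≡ᵇ b) Fixed + count (λ i → decoration i ≡ᵇ b) Moving
      ≡⟨ cong₂ _+_ onFixed onMoving ⟩
    fixedAt b + count (λ i → (c i ≡ᵇ colorOf r b) ∧ (move i ≡ᵇ b)) Moving
      ≡⟨ cong (fixedAt b +_) (proj₂ (proj₂ moved) (colorOf r b) b) ⟩
    fixedAt b + count (_≡ᵇ b) (slots (colorOf r b))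
      ≡⟨ cong (fixedAt b +_) (count-copies vacancies (colorClass r (colorOf r b)) b) ⟩
    fixedAt b + count (_≡ᵇ b) (colorClass r (colorOf r b)) * vacancies b
      ≡⟨ cong (λ n → fixedAt b + n * vacancies b)
              (count-≡ᵇ-∈ _ (colorClass-unique r _) (∈-colorClass⁺ r b 1≤b b≤r)) ⟩
    fixedAt b + 1 * vacancies b
      ≡⟨ cong (fixedAt b +_) (*-identityˡ (vacancies b)) ⟩
    fixedAt b + (k b ∸ fixedAt b)
      ≡⟨ m+[n∸m]≡n (fixedAt≤k b) ⟩
    k b ∎
    where
    onFixed : count (λ i → decoration i ≡ᵇ b) Fixed ≡ fixedAt b
    onFixed = count-cong Fixed λ i i∈ → cong (_≡ᵇ b) (decoration-fixed i (proj₂ (∈-Fixed⁻ i∈)))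

    onMoving : count (λ i → decoration i ≡ᵇ b) Moving ≡ count (λ i → (c i ≡ᵇ colorOf r b) ∧ (move i ≡ᵇ b)) Moving
    onMoving = count-cong Moving λ i i∈ →
      trans (cong (_≡ᵇ b) (decoration-moving i (proj₂ (∈-Moving⁻ i∈)))) (move≡ᵇ i i∈ b)

  noMerge : ∀ t s → ¬ (WantsToMerge r k decoration t s × HasPermission r k decoration t s)
  noMerge t s ((_ , _ , _ , _ , sameColor , s∈ , t<s , hs≡t) , _) with c s ≟ colorOf r s
  ... | yes fixed  = <-irrefl (trans (sym hs≡t) (decoration-fixed s fixed)) t<s
  ... | no  moving = moving (begin
    c s                        ≡⟨ colorOf-decoration s s∈ ⟨
    colorOf r (decoration s)   ≡⟨ cong (colorOf r) hs≡t ⟩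
    colorOf r t                ≡⟨ sameColor ⟩
    colorOf r s                ∎)

  isDecoration : Decoration r k decoration
  isDecoration = decoration-into , (λ b 1≤b b≤r _ → fibre≡k b 1≤b b≤r) ,
                 (λ i i∈ ki col → proj₂ (proj₂ mis) i i∈ ki (trans (sym (colorOf-decoration i i∈)) col)) ,
                 noMerge

mismatched⇒decoration : ∀ r k c → Mismatched r k c →
  Σ (ℕ → ℕ) λ h → Decoration r k h × (∀ i → i ∈ dom r → colorOf r (h i) ≡ c i)
mismatched⇒decoration r k c mis = decoration , isDecoration , colorOf-decoration
  where open FromMismatched r k c mis

lemma6p4 : (r : List ℕ) → 3 ≤ length r → All (1 ≤_) r →
    (k : ℕ → ℕ) → ExponentData r k →
    ((h : ℕ → ℕ) → Decoration r k h → Mismatched r k (λ i → colorOf r (h i))) ×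
    ((c : ℕ → ℕ) → Mismatched r k c →
      Σ (ℕ → ℕ) λ h → Decoration r k h × ((i : ℕ) → i ∈ dom r → colorOf r (h i) ≡ c i)) ×
    ((∃ λ h → Decoration r k h) ⇔ (∃ λ c → Mismatched r k c))
lemma6p4 r _ _ k _ =
  decoration⇒mismatched r k , mismatched⇒decoration r k ,
  mk⇔ (λ (h , dec) → _ , decoration⇒mismatched r k h dec)
      (λ (c , mis) → let h , dec , _ = mismatched⇒decoration r k c mis in h , dec)
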